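{- Let $\pi$ be a DI-sortable permutation of $[n]$ with ADI word $W$. Let $x\in[3n-1]$ and let $\pi_i=\min\{\pi_k : W(x) \text{ appears before } \mathsf{C}_{\pi_k} \text{ in } W\}$. If $\mathsf{E}_{\pi_i}$ appears before $W(x)$ in $W$, then $W(x)\neq\mathsf{E}$.
   Context: A permutation $\pi=\pi_1\cdots\pi_n$ of $[n]$ is processed by a machine consisting of an input (initially $\pi_1,\dots,\pi_n$, read left to right), a first stack, a second stack, and an output, with operations: $\mathsf{E}$ moves the next input entry onto the top of the first stack; $\mathsf{N}$ pops the top of the first stack and pushes it onto the second stack; $\mathsf{C}$ pops the top of the second stack to the output. A sorting word of $\pi$ is a word over $\{\mathsf{E},\mathsf{N},\mathsf{C}\}$ whose operations are all legal when applied in order starting from $\pi$ in the input and empty stacks, and whose final output is $12\cdots n$. A DI word is a sorting word during which the first stack's entries always decrease from top to bottom and the second stack's entries always increase from top to bottom; $\pi$ is DI-sortable if it has a DI word. $W(x)$ denotes the $x$-th letter of $W$. In a sorting word, the unique occurrences of $\mathsf{E},\mathsf{N},\mathsf{C}$ moving value $j$ are denoted $\mathsf{E}_j,\mathsf{N}_j,\mathsf{C}_j$. The ADI word of a DI-sortable $\pi$ is the word of operations performed by the following algorithm, which at each stage performs the first applicable step: (1) if the top entry of the second stack is the smallest value not yet output, perform $\mathsf{C}$; (2) if the first stack is nonempty and its $m$ entries are exactly the next $m$ values to be output, transfer all of them to the second stack by $m$ successive $\mathsf{N}$ operations; (3) otherwise, if the next input entry is smaller than the top of the second stack and larger than the top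 of the first stack (each comparison counting as satisfied if the corresponding stack is empty), perform $\mathsf{E}$; (4) otherwise perform $\mathsf{N}$. It is known that for every DI-sortable permutation this algorithm produces a DI word of it. -}

module Defs where

open import Data.Nat using (ℕ; zero; suc; _+_; _*_; _<_; _>_; _<ᵇ_; _≡ᵇ_)
open import Data.Bool using (Bool; true; false; _∧_; _∨_; not; if_then_else_)
open import Data.List using (List; []; _∷_; _++_; [_]; length; take; applyUpTo; replicate)
open import Data.List.Relation.Unary.Linked using (Linked)
open import Data.List.Relation.Binary.Permutation.Propositional using (_↭_)
open import Data.Maybe using (Maybe; just; nothing)
open import Data.Product using (_×_; _,_; ∃; Σ)
open import Relation.Binary.PropositionalEquality using (_≡_)

range : ℕ → List ℕ
range n = applyUpTo suc n

IsPerm : ℕ → List ℕ → Set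
IsPerm n π = π ↭ range n

-- The machine.  Stacks are lists with the top entry at the head;
-- the output is listed in the order it was produced.

data Op : Set where
  E N C : Op

record State : Set where
  constructor ⟨_,_,_,_⟩
  field
    inp  : List ℕ
    st1  : List ℕ
    st2  : List ℕ
    out  : List ℕ
open State public

initial : List ℕ → State
initial π = ⟨ π , [] , [] , [] ⟩

step : Op → State → Maybe (ℕ × State)
step E ⟨ x ∷ i , a , b , o ⟩ = just (x , ⟨ i , x ∷ a , b , o ⟩)
step N ⟨ i , x ∷ a , b , o ⟩ = just (x , ⟨ i , a , x ∷ b , o ⟩)
step C ⟨ i , a , x ∷ b , o ⟩ = just (x , ⟨ i , a , b , o ++ [ x ] ⟩)
step _ _ = nothing

run : List Op → State → Maybe State
run [] s = just s
run (o ∷ w) s with step o s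
... | nothing = nothing
... | just (_ , s') = run w s'

SortingWord : ℕ → List ℕ → List Op → Set
SortingWord n π W = ∃ λ t → run W (initial π) ≡ just t × out t ≡ range n

DIOK : State → Set
DIOK s = Linked _>_ (st1 s) × Linked _<_ (st2 s)

data DIRun : State → List Op → State → Set where
  done : ∀ {s} → DIRun s [] s
  more : ∀ {s o v s' w t} → step o s ≡ just (v , s') → DIOK s' →
         DIRun s' w t → DIRun s (o ∷ w) t

DIWord : ℕ → List ℕ → List Op → Set
DIWord n π W = ∃ λ t → DIRun (initial π) W t × out t ≡ range n

DISortable : ℕ → List ℕ → Set
DISortable n π = ∃ λ W → DIWord n π W

-- Labelled trace: the x-th entry is (W(x), value moved by W(x)).
-- So (E , j) occurs at position x iff W(x) = E_j, etc.

trace : List Op → State → List (Op × ℕ)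
trace [] s = []
trace (o ∷ w) s with step o s
... | nothing = []
... | just (v , s') = (o , v) ∷ trace w s'

-- 1-indexed lookup: xs ! 1 is the first entry
_!_ : {A : Set} → List A → ℕ → Maybe A
[] ! _ = nothing
(x ∷ xs) ! zero = nothing
(x ∷ xs) ! suc zero = just x
(x ∷ xs) ! suc (suc k) = xs ! suc k

elemᵇ : ℕ → List ℕ → Bool
elemᵇ v [] = false
elemᵇ v (y ∷ ys) = (y ≡ᵇ v) ∨ elemᵇ v ys

allᵇ : (ℕ → Bool) → List ℕ → Bool
allᵇ p [] = true
allᵇ p (y ∷ ys) = p y ∧ allᵇ p ys

notOutput : List ℕ → List ℕ → List ℕ
notOutput o [] = []
notOutput o (v ∷ vs) = if elemᵇ v o then notOutput o vs else v ∷ notOutput o vs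

pending : ℕ → State → List ℕ
pending n s = notOutput (out s) (range n)

rule1 : ℕ → State → Bool
rule1 n s with st2 s | pending n s
... | x ∷ _ | y ∷ _ = x ≡ᵇ y
... | _ | _ = false

rule2 : ℕ → State → Bool
rule2 n s with st1 s
... | [] = false
... | a@(_ ∷ _) =
  let nxt = take (length a) (pending n s) in
  allᵇ (λ y → elemᵇ y nxt) a ∧ allᵇ (λ y → elemᵇ y a) nxt

rule3 : State → Bool
rule3 s with inp s
... | [] = false
... | x ∷ _ = below (st2 s) ∧ above (st1 s)
  where
  below : List ℕ → Bool
  below [] = true
  below (t ∷ _) = x <ᵇ t
  above : List ℕ → Bool
  above [] = true
  above (t ∷ _) = t <ᵇ x

stage : ℕ → State → List Op
stage n s =
  if rule1 n s then [ C ]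
  else if rule2 n s then replicate (length (st1 s)) N
  else if rule3 s then [ E ]
  else [ N ]

finished : State → Bool
finished ⟨ [] , [] , [] , _ ⟩ = true
finished _ = false

adiGo : ℕ → ℕ → State → List Op
adiGo n zero s = []
adiGo n (suc k) s =
  if finished s then []
  else go (stage n s)
  where
  go : List Op → List Op
  go ops with run ops s
  ... | nothing = ops
  ... | just s' = ops ++ adiGo n k s'

-- ADI word of π (π a permutation of [n]); every stage performs ≥ 1
-- operation and a sorting word has 3n letters, so 3n stages suffice.
ADI : ℕ → List ℕ → List Op
ADI n π = adiGo n (3 * n) (initial π)

module Submission where

-- The argument only uses properties of the states visited by the ADI
-- algorithm:
--   * Invariant: the values of the output and of the machine form a
--     permutation of [n]; the first stack decreases, the second increases,
--     the first stack lies below the top of the second; and when the first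
--     stack holds at least two entries, the next value to be output is not
--     among them.  Every stage of ADI is a single operation preserving it.
--   * Output order: C only ever outputs the next pending value, so values
--     are output in increasing order; hence the least value output from a
--     state on is the next pending value of that state.
--   * When ADI reads, the next value is on neither stack (else rule (1) or
--     rule (2) would fire).
-- At step x the value v has been read, is not yet output, and (by the output
-- order) is the next value; so it lies on a stack and step x cannot be E.

open import Defs
open import Data.Nat using (ℕ; zero; suc; _<_; _≤_; _>_; _*_; _∸_; _≡ᵇ_; z≤n; s≤s)
open import Data.Nat.Properties
  using (≡ᵇ⇒≡; <ᵇ⇒<; ≤-refl; <⇒≤; <-trans; <⇒≢; <⇒≱; ≤-antisym; m≤n⇒m≤1+n; m≤n⇒m<n∨m≡n;
         _≟_)
open import Data.Bool using (true; false; T; _∧_)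
open import Data.Bool.Properties using (∨-zeroʳ)
open import Data.Unit using (tt)
open import Data.Empty using (⊥; ⊥-elim)
open import Data.Sum using (_⊎_; inj₁; inj₂; [_,_]′)
open import Data.Product using (_×_; _,_; ∃; ∃₂; proj₁)
open import Data.Maybe using (just; nothing)
open import Data.Maybe.Relation.Binary.Connected using (Connected; just; just-nothing)
open import Data.List using (List; []; _∷_; _++_; [_]; length; take; head)
import Data.List.Properties as List
open import Data.List.Relation.Unary.Any using (here; there)
open import Data.List.Relation.Unary.All as All using (All; []; _∷_)
open import Data.List.Relation.Unary.AllPairs as AllPairs using (AllPairs; []; _∷_)
import Data.List.Relation.Unary.AllPairs.Properties as AllPairs
open import Data.List.Relation.Unary.Linked as Linked using (Linked; []; _∷′_)
open import Data.List.Relation.Unary.Linked.Properties using (Linked⇒AllPairs)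
open import Data.List.Relation.Unary.Unique.Propositional using (Unique)
open import Data.List.Relation.Unary.Unique.Propositional.Properties using (Unique[x∷xs]⇒x∉xs)
open import Data.List.Membership.Propositional using (_∈_; _∉_)
open import Data.List.Membership.Propositional.Properties using (∈-++⁺ˡ; ∈-++⁺ʳ; ∈-++⁻)
open import Data.List.Relation.Binary.Permutation.Propositional
  using (_↭_; ↭-sym; ↭-trans; ↭-reflexive; ↭⇒↭ₛ)
open import Data.List.Relation.Binary.Permutation.Propositional.Properties
  using (∈-resp-↭; ++⁺ˡ; shift)
open import Data.List.Relation.Binary.Permutation.Setoid.Properties using (Unique-resp-↭)
open import Relation.Nullary using (yes; no)
open import Relation.Binary.PropositionalEquality
  using (_≡_; _≢_; refl; sym; trans; cong; subst; setoid)

private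
  variable
    n k x z u v w m : ℕ
    xs ys tl : List ℕ
    o : Op
    s s′ : State

T-true : ∀ {b} → b ≡ true → T b
T-true refl = tt

∧-true : ∀ {b c} → (b ∧ c) ≡ true → b ≡ true × c ≡ true
∧-true {true} {true} refl = refl , refl

≡ᵇ-refl : ∀ m → (m ≡ᵇ m) ≡ true
≡ᵇ-refl zero = refl
≡ᵇ-refl (suc m) = ≡ᵇ-refl m

elemᵇ⇒∈ : ∀ xs → elemᵇ v xs ≡ true → v ∈ xs
elemᵇ⇒∈ {v} (y ∷ ys) h with y ≡ᵇ v in eq
... | true = here (sym (≡ᵇ⇒≡ y v (T-true eq)))
... | false = there (elemᵇ⇒∈ ys h)

∈⇒elemᵇ : v ∈ xs → elemᵇ v xs ≡ true
∈⇒elemᵇ {v} (here refl) rewrite ≡ᵇ-refl v = refl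
∈⇒elemᵇ {v} {y ∷ ys} (there p) rewrite ∈⇒elemᵇ p = ∨-zeroʳ (y ≡ᵇ v)

elemᵇ-false⇒∉ : elemᵇ v xs ≡ false → v ∉ xs
elemᵇ-false⇒∉ h p with () ← trans (sym (∈⇒elemᵇ p)) h

head-least : AllPairs _<_ (m ∷ xs) → w ∈ m ∷ xs → m ≤ w
head-least _ (here refl) = ≤-refl
head-least (m<xs ∷ _) (there p) = <⇒≤ (All.lookup m<xs p)

range-sorted : ∀ n → AllPairs _<_ (range n)
range-sorted n = AllPairs.applyUpTo⁺₁ suc n (λ i<j _ → s≤s i<j)

notOutput⁻ : ∀ {o} xs → w ∈ notOutput o xs → w ∈ xs × w ∉ o
notOutput⁻ {o = o} (y ∷ ys) p with elemᵇ y o in eq | p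
... | true | p′ with p′ , w∉o ← notOutput⁻ ys p′ = there p′ , w∉o
... | false | here refl = here refl , elemᵇ-false⇒∉ eq
... | false | there p′ with p′ , w∉o ← notOutput⁻ ys p′ = there p′ , w∉o

notOutput⁺ : ∀ {o} → w ∈ xs → w ∉ o → w ∈ notOutput o xs
notOutput⁺ {xs = y ∷ ys} {o = o} p w∉o with elemᵇ y o in eq | p
... | true | here refl = ⊥-elim (w∉o (elemᵇ⇒∈ o eq))
... | true | there p′ = notOutput⁺ p′ w∉o
... | false | here refl = here refl
... | false | there p′ = there (notOutput⁺ p′ w∉o)

notOutput-sorted : ∀ {o} → AllPairs _<_ xs → AllPairs _<_ (notOutput o xs)
notOutput-sorted [] = []
notOutput-sorted {xs = y ∷ ys} {o = o} (y<ys ∷ sorted) with elemᵇ y o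
... | true = notOutput-sorted sorted
... | false =
  All.tabulate (λ p → All.lookup y<ys (proj₁ (notOutput⁻ ys p))) ∷ notOutput-sorted sorted

Pending : ℕ → State → ℕ → Set
Pending n s w = w ∈ range n × w ∉ out s

∈-pending⁺ : Pending n s w → w ∈ pending n s
∈-pending⁺ (w∈ , w∉) = notOutput⁺ w∈ w∉

next-pending : pending n s ≡ m ∷ tl → Pending n s m
next-pending {n} eq = notOutput⁻ (range n) (subst (_ ∈_) (sym eq) (here refl))

next-least : pending n s ≡ m ∷ tl → Pending n s w → m ≤ w
next-least {n} {s} eq pw =
  head-least (subst (AllPairs _<_) eq (notOutput-sorted {o = out s} (range-sorted n)))
             (subst (_ ∈_) eq (∈-pending⁺ {n = n} {s = s} pw))

pending-nonempty : Pending n s w → ∃₂ λ m tl → pending n s ≡ m ∷ tl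
pending-nonempty {n} {s} pw = nonempty (∈-pending⁺ {n = n} {s = s} pw)
  where
  nonempty : w ∈ xs → ∃₂ λ m tl → xs ≡ m ∷ tl
  nonempty (here _) = _ , _ , refl
  nonempty (there _) = _ , _ , refl

rule1⇒next-on-top : ∀ n s → rule1 n s ≡ true →
  ∃₂ λ t r → st2 s ≡ t ∷ r × ∃ λ tl → pending n s ≡ t ∷ tl
rule1⇒next-on-top n s h with st2 s | pending n s
... | t ∷ r | m ∷ tl = t , r , refl , tl , cong (_∷ tl) (sym (≡ᵇ⇒≡ t m (T-true h)))

next-on-top⇒rule1 : ∀ n s → st2 s ≡ v ∷ xs → pending n s ≡ v ∷ tl → rule1 n s ≡ true
next-on-top⇒rule1 n s e₂ ep with st2 s | pending n s
next-on-top⇒rule1 {v = v} n s refl refl | _ | _ = ≡ᵇ-refl v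

next-alone⇒rule2 : ∀ n s → st1 s ≡ [ v ] → pending n s ≡ v ∷ tl → rule2 n s ≡ true
next-alone⇒rule2 n s e₁ ep with st1 s
next-alone⇒rule2 {v = v} n s refl ep | _ rewrite ep | ≡ᵇ-refl v = refl

rule2⇒next-on-st1 : ∀ n s → rule2 n s ≡ true → pending n s ≡ m ∷ tl → m ∈ st1 s
rule2⇒next-on-st1 {m = m} {tl = tl} n s h ep with st1 s
... | a@(_ ∷ _) rewrite ep
  with _ , next-in-a ← ∧-true {b = allᵇ (λ y → elemᵇ y (take (length a) (m ∷ tl))) a} h
  with m∈a , _ ← ∧-true next-in-a = elemᵇ⇒∈ a m∈a

rule3⇒fits : ∀ s → rule3 s ≡ true →
  ∃₂ λ e i → inp s ≡ e ∷ i ×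
              Connected _<_ (just e) (head (st2 s)) × Connected _>_ (just e) (head (st1 s))
rule3⇒fits s h with inp s
... | e ∷ i with st2 s | st1 s
... | [] | [] = e , i , refl , just-nothing , just-nothing
... | [] | a ∷ _ = e , i , refl , just-nothing , just (<ᵇ⇒< a e (T-true h))
... | t ∷ _ | [] = e , i , refl , just (<ᵇ⇒< e t (T-true (proj₁ (∧-true h)))) , just-nothing
... | t ∷ _ | a ∷ _ with e<t , a<e ← ∧-true h =
  e , i , refl , just (<ᵇ⇒< e t (T-true e<t)) , just (<ᵇ⇒< a e (T-true a<e))

unique-++ʳ : Unique (xs ++ ys) → Unique ys
unique-++ʳ {xs = []} u = u
unique-++ʳ {xs = _ ∷ xs} (_ ∷ u) = unique-++ʳ {xs = xs} u

unique-disjoint : Unique (xs ++ ys) → w ∈ ys → w ∉ xs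
unique-disjoint {xs = x ∷ xs} (x≢ ∷ _) w∈ys (here refl) = All.lookup x≢ (∈-++⁺ʳ xs w∈ys) refl
unique-disjoint {xs = _ ∷ _} (_ ∷ u) w∈ys (there w∈xs) = unique-disjoint u w∈ys w∈xs

machine : State → List ℕ
machine s = inp s ++ st1 s ++ st2 s

UnderTop : List ℕ → List ℕ → Set
UnderTop a b = All (λ w → Connected _<_ (just w) (head b)) a

record Invariant (n : ℕ) (s : State) : Set where
  field
    conserved    : out s ++ machine s ↭ range n
    st1-dec      : Linked _>_ (st1 s)
    st2-inc      : Linked _<_ (st2 s)
    st1-under    : UnderTop (st1 s) (st2 s)
    next-shallow : 2 ≤ length (st1 s) → pending n s ≡ m ∷ tl → m ∉ st1 s
open Invariant

initial-invariant : ∀ {π} → IsPerm n π → Invariant n (initial π)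
initial-invariant {π = π} perm = record
  { conserved = ↭-trans (↭-reflexive (List.++-identityʳ π)) perm
  ; st1-dec = []
  ; st2-inc = []
  ; st1-under = []
  ; next-shallow = λ ()
  }

machine-unique : Invariant n s → Unique (out s ++ machine s)
machine-unique {n} I =
  Unique-resp-↭ (setoid ℕ) (↭⇒↭ₛ (↭-sym (conserved I))) (AllPairs.map <⇒≢ (range-sorted n))

machine-pending : Invariant n s → w ∈ machine s → Pending n s w
machine-pending {s = s} I w∈ =
  ∈-resp-↭ (conserved I) (∈-++⁺ʳ (out s) w∈) , unique-disjoint (machine-unique I) w∈

st1-pending : Invariant n s → w ∈ st1 s → Pending n s w
st1-pending {s = s} I w∈ = machine-pending I (∈-++⁺ʳ (inp s) (∈-++⁺ˡ w∈))

st2-pending : Invariant n s → w ∈ st2 s → Pending n s w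
st2-pending {s = s} I w∈ = machine-pending I (∈-++⁺ʳ (inp s) (∈-++⁺ʳ (st1 s) w∈))

read-on-stacks : Invariant n s → Pending n s w → w ∉ inp s → w ∈ st1 s ⊎ w ∈ st2 s
read-on-stacks {s = s} I (w∈range , w∉out) w∉inp
  with ∈-++⁻ (out s) (∈-resp-↭ (↭-sym (conserved I)) w∈range)
... | inj₁ w∈out = ⊥-elim (w∉out w∈out)
... | inj₂ w∈machine with ∈-++⁻ (inp s) w∈machine
...   | inj₁ w∈inp = ⊥-elim (w∉inp w∈inp)
...   | inj₂ w∈stacks = ∈-++⁻ (st1 s) w∈stacks

data Choice (n : ℕ) (s : State) : Op → Set where
  pop  : rule1 n s ≡ true → Choice n s C
  push : rule1 n s ≡ false → rule2 n s ≡ false → rule3 s ≡ true → Choice n s E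
  move : Choice n s N

-- Rule (2) only fires on a one-entry first stack (by `next-shallow`).
transfer-single : Invariant n s → rule2 n s ≡ true → length (st1 s) ≡ 1
transfer-single {s = ⟨ _ , [] , _ , _ ⟩} I ()
transfer-single {s = ⟨ _ , _ ∷ [] , _ , _ ⟩} I _ = refl
transfer-single {n = n} {s = s@(⟨ _ , _ ∷ _ ∷ _ , _ , _ ⟩)} I r2
  with _ , _ , ep ← pending-nonempty {n = n} {s = s} (st1-pending I (here refl))
  = ⊥-elim (next-shallow I (s≤s (s≤s z≤n)) ep (rule2⇒next-on-st1 n s r2 ep))

stage-choice : Invariant n s → ∃ λ o → stage n s ≡ [ o ] × Choice n s o
stage-choice {n} {s} I with rule1 n s in r1 | rule2 n s in r2 | rule3 s in r3
... | true | _ | _ = C , refl , pop r1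
... | false | true | _ rewrite transfer-single I r2 = N , refl , move
... | false | false | true = E , refl , push r1 r2 r3
... | false | false | false = N , refl , move

pop-outputs-next : ∀ n s → rule1 n s ≡ true → step C s ≡ just (u , s′) →
  ∃ λ tl → pending n s ≡ u ∷ tl
pop-outputs-next n s@(⟨ _ , _ , _ ∷ _ , _ ⟩) r1 refl
  with _ , _ , refl , tl , ep ← rule1⇒next-on-top n s r1 = tl , ep

move-preserves : Invariant n s → step N s ≡ just (u , s′) → Invariant n s′
move-preserves {s = ⟨ i , a₁ ∷ a , b , o ⟩} I refl = record
  { conserved = ↭-trans (++⁺ˡ o (++⁺ˡ i (shift a₁ a b))) (conserved I)
  ; st1-dec = Linked.tail (st1-dec I)
  ; st2-inc = All.head (st1-under I) ∷′ st2-inc I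
  ; st1-under = All.map just (AllPairs.head (Linked⇒AllPairs (λ p q → <-trans q p) (st1-dec I)))
  ; next-shallow = λ 2≤ ep m∈a → next-shallow I (m≤n⇒m≤1+n 2≤) ep (there m∈a)
  }

-- Outputting keeps the invariant; the first stack is then empty, since its
-- entries lie below the top of the second stack, which is the next value.
pop-preserves : Invariant n s → rule1 n s ≡ true → step C s ≡ just (u , s′) → Invariant n s′
pop-preserves {n} {s@(⟨ _ , _ ∷ _ , _ ∷ _ , _ ⟩)} I r1 refl
  with _ , ep ← pop-outputs-next n s r1 refl | just a₁<t ← All.head (st1-under I)
  = ⊥-elim (<⇒≱ a₁<t (next-least {n = n} {s = s} ep (st1-pending I (here refl))))
pop-preserves {s = ⟨ i , [] , t ∷ b , o ⟩} I r1 refl = record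
  { conserved = ↭-trans (↭-reflexive (List.++-assoc o [ t ] (i ++ b)))
                  (↭-trans (++⁺ˡ o (↭-sym (shift t i b))) (conserved I))
  ; st1-dec = []
  ; st2-inc = Linked.tail (st2-inc I)
  ; st1-under = []
  ; next-shallow = λ ()
  }

-- After a read the next value is still not deep in the first stack: the
-- new top e exceeds the old top, which is pending, so e is not the next
-- value; and rule (2) did not fire, so a single old entry is not it either.
read-next-shallow : Invariant n s → rule2 n s ≡ false → Connected _>_ (just v) (head (st1 s)) →
  2 ≤ length (v ∷ st1 s) → pending n s ≡ m ∷ tl → m ∉ v ∷ st1 s
read-next-shallow {s = ⟨ _ , [] , _ , _ ⟩} I r2 _ (s≤s ())
read-next-shallow {n} {s@(⟨ _ , _ ∷ _ , _ , _ ⟩)} I r2 (just a₁<v) _ ep (here refl) =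
  <⇒≱ a₁<v (next-least {n = n} {s = s} ep (st1-pending I (here refl)))
read-next-shallow {n} {s@(⟨ _ , _ ∷ [] , _ , _ ⟩)} I r2 _ _ ep (there (here refl))
  with () ← trans (sym r2) (next-alone⇒rule2 n s refl ep)
read-next-shallow {s = ⟨ _ , _ ∷ _ ∷ _ , _ , _ ⟩} I r2 _ _ ep (there m∈a) =
  next-shallow I (s≤s (s≤s z≤n)) ep m∈a

push-preserves : Invariant n s → rule2 n s ≡ false → rule3 s ≡ true →
  step E s ≡ just (u , s′) → Invariant n s′
push-preserves {s = s@(⟨ e ∷ i , a , b , o ⟩)} I r2 r3 refl
  with _ , _ , refl , e<top₂ , e>top₁ ← rule3⇒fits s r3 = record
  { conserved = ↭-trans (++⁺ˡ o (shift e i (a ++ b))) (conserved I)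
  ; st1-dec = e>top₁ ∷′ st1-dec I
  ; st2-inc = st2-inc I
  ; st1-under = e<top₂ ∷ st1-under I
  ; next-shallow = read-next-shallow I r2 e>top₁
  }

choice-preserves : Invariant n s → Choice n s o → step o s ≡ just (u , s′) → Invariant n s′
choice-preserves I (pop r1) st = pop-preserves I r1 st
choice-preserves I (push _ r2 r3) st = push-preserves I r2 r3 st
choice-preserves I move st = move-preserves I st

adiTrace : ℕ → ℕ → State → List (Op × ℕ)
adiTrace n k s = trace (adiGo n k s) s

data Unfolding (n k : ℕ) (s : State) : List Op → List (Op × ℕ) → Set where
  halt : ∀ {W} → Unfolding n k s W []
  next : ∀ o u s′ → Choice n s o → step o s ≡ just (u , s′) → Invariant n s′ →
         Unfolding n k s (o ∷ adiGo n k s′) ((o , u) ∷ adiTrace n k s′)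

-- (`stp` is rewritten twice: once in the run of the stage, and once in the
-- trace of the resulting word, which only appears after the first rewrite.)
unfold : Invariant n s → Unfolding n k s (adiGo n (suc k) s) (adiTrace n (suc k) s)
unfold {n} {s} {k} I with o , stg , ch ← stage-choice I | finished s | step o s in stp
... | true | _ = halt
... | false | nothing rewrite stg | stp | stp = halt
... | false | just (u , s′) rewrite stg | stp | stp = next o u s′ ch stp (choice-preserves I ch stp)

-- Positions in traces (1-indexed, as in `_!_`): `After x L a` says that a
-- occurs in L at a position after x, `Before x L a` at one before x.

After Before : ℕ → List (Op × ℕ) → Op × ℕ → Set
After x L a = ∃ λ y → x < y × L ! y ≡ just a
Before x L a = ∃ λ y → y < x × L ! y ≡ just a

!-zero : ∀ {A : Set} {a : A} (L : List A) → L ! 0 ≢ just a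
!-zero [] ()
!-zero (_ ∷ _) ()

!-[] : ∀ {A : Set} {a : A} y → [] ! y ≢ just a
!-[] zero ()
!-[] (suc _) ()

after-[] : ∀ {a} → After x [] a → ⊥
after-[] (y , _ , h) = !-[] y h

after-tail : ∀ {a b L} → After (suc x) (b ∷ L) a → After x L a
after-tail (suc (suc y) , s≤s x<1+y , h) = suc y , x<1+y , h

after-cons : ∀ {a b L} → After x L a → After (suc x) (b ∷ L) a
after-cons {L = L} (zero , _ , h) = ⊥-elim (!-zero L h)
after-cons (suc y , x<1+y , h) = suc (suc y) , s≤s x<1+y , h

before-cons : ∀ {a b L} → Before x L a → Before (suc x) (b ∷ L) a
before-cons {L = L} (zero , _ , h) = ⊥-elim (!-zero L h)
before-cons (suc y , 1+y<x , h) = suc (suc y) , s≤s 1+y<x , h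


before-tail : ∀ {a b L} → Before (suc (suc x)) (b ∷ L) a → a ≡ b ⊎ Before (suc x) L a
before-tail {b = b} {L = L} (zero , _ , h) = ⊥-elim (!-zero (b ∷ L) h)
before-tail (suc zero , _ , refl) = inj₁ refl
before-tail (suc (suc y) , s≤s 1+y<1+x , h) = inj₂ (suc y , 1+y<1+x , h)

pending-step : step o s ≡ just (u , s′) → Pending n s w → (o , u) ≡ (C , w) ⊎ Pending n s′ w
pending-step {o = E} {s = ⟨ _ ∷ _ , _ , _ , _ ⟩} refl pw = inj₂ pw
pending-step {o = N} {s = ⟨ _ , _ ∷ _ , _ , _ ⟩} refl pw = inj₂ pw
pending-step {o = C} {s = ⟨ _ , _ , t ∷ _ , o ⟩} {w = w} refl (w∈range , w∉o) with t ≟ w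
... | yes refl = inj₁ refl
... | no t≢w =
  inj₂ (w∈range , λ w∈ → [ w∉o , (λ { (here w≡t) → t≢w (sym w≡t) }) ]′ (∈-++⁻ o w∈))

pending-backward : step o s ≡ just (u , s′) → Pending n s′ w → Pending n s w
pending-backward {o = E} {s = ⟨ _ ∷ _ , _ , _ , _ ⟩} refl pw = pw
pending-backward {o = N} {s = ⟨ _ , _ ∷ _ , _ , _ ⟩} refl pw = pw
pending-backward {o = C} {s = ⟨ _ , _ , _ ∷ _ , _ ⟩} refl (w∈range , w∉out) =
  w∈range , λ w∈ → w∉out (∈-++⁺ˡ w∈)

read-keeps-pending : step E s ≡ just (u , s′) → pending n s′ ≡ pending n s
read-keeps-pending {s = ⟨ _ ∷ _ , _ , _ , _ ⟩} refl = refl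

input-shrinks : step o s ≡ just (u , s′) → w ∉ inp s → w ∉ inp s′
input-shrinks {o = E} {s = ⟨ _ ∷ _ , _ , _ , _ ⟩} refl w∉ = λ w∈ → w∉ (there w∈)
input-shrinks {o = N} {s = ⟨ _ , _ ∷ _ , _ , _ ⟩} refl w∉ = w∉
input-shrinks {o = C} {s = ⟨ _ , _ , _ ∷ _ , _ ⟩} refl w∉ = w∉

-- the values of the machine are distinct, so a value read is no longer in the input
read-leaves-input : Invariant n s → step E s ≡ just (u , s′) → u ∉ inp s′
read-leaves-input {s = ⟨ _ ∷ _ , _ , _ , o ⟩} I refl e∈i =
  Unique[x∷xs]⇒x∉xs (unique-++ʳ {xs = o} (machine-unique I)) (∈-++⁺ˡ e∈i)

output-pending : Invariant n s → adiTrace n k s ! z ≡ just (C , v) → Pending n s v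
output-pending {k = zero} {z = z} _ h = ⊥-elim (!-[] z h)
output-pending {n} {s} {suc k} {z} I h with adiGo n (suc k) s | adiTrace n (suc k) s | unfold {k = k} I
output-pending {z = z} _ h | _ | _ | halt = ⊥-elim (!-[] z h)
output-pending {n} {s} {z = suc zero} _ refl | _ | _ | next _ _ _ (pop r1) stp _
  with _ , ep ← pop-outputs-next n s r1 stp = next-pending {n = n} {s = s} ep
output-pending {k = suc k} {z = suc (suc z)} _ h | _ | _ | next _ _ _ _ stp I′ =
  pending-backward stp (output-pending {k = k} {z = suc z} I′ h)

smaller-output-first : Invariant n s → adiTrace n k s ! z ≡ just (C , v) → Pending n s w → w < v →
  Before z (adiTrace n k s) (C , w)
smaller-output-first {k = zero} {z = z} _ h = ⊥-elim (!-[] z h)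
smaller-output-first {n} {s} {suc k} {z} I h pw w<v
  with adiGo n (suc k) s | adiTrace n (suc k) s | unfold {k = k} I
smaller-output-first {z = z} _ h _ _ | _ | _ | halt = ⊥-elim (!-[] z h)
smaller-output-first {n} {s} {z = suc zero} _ refl pw w<v | _ | _ | next _ _ _ (pop r1) stp _
  with _ , ep ← pop-outputs-next n s r1 stp = ⊥-elim (<⇒≱ w<v (next-least {n = n} {s = s} ep pw))
smaller-output-first {k = suc k} {z = suc (suc z)} _ h pw w<v | _ | _ | next _ _ _ _ stp I′
  with pending-step stp pw
... | inj₁ refl = 1 , s≤s (s≤s z≤n) , refl
... | inj₂ pw′ = before-cons (smaller-output-first {k = k} {z = suc z} I′ h pw′ w<v)

least-output-is-next : Invariant n s → After 0 (adiTrace n k s) (C , v) →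
  (∀ w → w ∈ range n → After 0 (adiTrace n k s) (C , w) → v ≤ w) →
  ∃ λ tl → pending n s ≡ v ∷ tl
least-output-is-next {n} {s} {k} I (z , _ , h) least
  with m , tl , ep ← pending-nonempty {n = n} {s = s} (output-pending {k = k} I h)
  with m≤n⇒m<n∨m≡n (next-least {n = n} {s = s} ep (output-pending {k = k} I h))
... | inj₂ refl = tl , ep
... | inj₁ m<v with smaller-output-first {k = k} I h (next-pending {n = n} {s = s} ep) m<v
...   | zero , _ , h′ = ⊥-elim (!-zero (adiTrace n k s) h′)
...   | suc y , _ , h′ =
  ⊥-elim (<⇒≱ m<v (least m (proj₁ (next-pending {n = n} {s = s} ep)) (suc y , s≤s z≤n , h′)))

-- When ADI reads, the next value is on neither stack: on the second stack it
-- would be the top, so rule (1) would fire; on the first stack it would be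
-- the only entry (by `next-shallow`), so rule (2) would fire.
read-next-off-stacks : Invariant n s → rule1 n s ≡ false → rule2 n s ≡ false →
  pending n s ≡ m ∷ tl → m ∈ st1 s ⊎ m ∈ st2 s → ⊥
read-next-off-stacks {n} {s@(⟨ _ , _ , t ∷ _ , _ ⟩)} I r1 _ ep (inj₂ m∈b)
  with ≤-antisym (head-least (Linked⇒AllPairs <-trans (st2-inc I)) m∈b)
                 (next-least {n = n} {s = s} ep (st2-pending I (here refl)))
... | refl with () ← trans (sym r1) (next-on-top⇒rule1 n s refl ep)
read-next-off-stacks {n} {s@(⟨ _ , _ ∷ [] , _ , _ ⟩)} I _ r2 ep (inj₁ (here refl))
  with () ← trans (sym r2) (next-alone⇒rule2 n s refl ep)
read-next-off-stacks {s = ⟨ _ , _ ∷ _ ∷ _ , _ , _ ⟩} I _ _ ep (inj₁ m∈a) =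
  next-shallow I (s≤s (s≤s z≤n)) ep m∈a

-- Whether v has been read is tracked along the run: before step 1 it is
-- recorded by the state alone, and it survives each step.
read-status-first : ∀ {L} → v ∉ inp s ⊎ Before 1 L (E , v) → v ∉ inp s
read-status-first (inj₁ v∉inp) = v∉inp
read-status-first {L = L} (inj₂ (zero , _ , h)) = ⊥-elim (!-zero L h)
read-status-first (inj₂ (suc _ , s≤s () , _))

read-status-step : ∀ {L} → Invariant n s → step o s ≡ just (u , s′) →
  v ∉ inp s ⊎ Before (suc (suc x)) ((o , u) ∷ L) (E , v) → v ∉ inp s′ ⊎ Before (suc x) L (E , v)
read-status-step I stp (inj₁ v∉inp) = inj₁ (input-shrinks stp v∉inp)
read-status-step I stp (inj₂ read-before) with before-tail read-before
... | inj₁ refl = inj₁ (read-leaves-input I stp)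
... | inj₂ read-before′ = inj₂ read-before′

no-read-at : Invariant n s → 1 ≤ x →
  v ∉ inp s ⊎ Before x (adiTrace n k s) (E , v) →
  After x (adiTrace n k s) (C , v) →
  (∀ w → w ∈ range n → After x (adiTrace n k s) (C , w) → v ≤ w) →
  adiGo n k s ! x ≢ just E
no-read-at {x = x} {k = zero} _ _ _ _ _ h = !-[] x h
no-read-at {n} {s} {k = suc k} I _ read later least step-x
  with adiGo n (suc k) s | adiTrace n (suc k) s | unfold {k = k} I
... | _ | _ | halt = after-[] later
no-read-at {n} {s} {suc zero} {v} {suc k} I _ read later least refl
    | _ | _ | next E _ s′ (push r1 r2 _) stp I′
  with tl , ep′ ← least-output-is-next {k = k} I′ (after-tail later) (λ w w∈ h → least w w∈ (after-cons h)) =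
  read-next-off-stacks I r1 r2 ep (read-on-stacks I v-pending v∉inp)
  where
  ep : pending n s ≡ v ∷ tl
  ep = trans (sym (read-keeps-pending {n = n} stp)) ep′
  v-pending : Pending n s v
  v-pending = next-pending {n = n} {s = s} ep
  v∉inp : v ∉ inp s
  v∉inp = read-status-first {s = s} {L = _ ∷ adiTrace n k s′} read
no-read-at {x = suc (suc x)} {k = suc k} I _ read later least step-x | _ | _ | next _ _ _ _ stp I′ =
  no-read-at {k = k} I′ (s≤s z≤n) (read-status-step I stp read) (after-tail later)
    (λ w w∈ h → least w w∈ (after-cons h)) step-x

corollary2p13 : (n : ℕ) (π : List ℕ) → IsPerm n π → DISortable n π →
    (x : ℕ) → 1 ≤ x → x ≤ 3 * n ∸ 1 →
    (v : ℕ) →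
    (v ∈ π × ∃ λ y → x < y × trace (ADI n π) (initial π) ! y ≡ just (C , v)) →
    (∀ w → w ∈ π → (∃ λ y → x < y × trace (ADI n π) (initial π) ! y ≡ just (C , w)) → v ≤ w) →
    (∃ λ y → y < x × trace (ADI n π) (initial π) ! y ≡ just (E , v)) →
    ADI n π ! x ≢ just E
corollary2p13 n π perm _ x 1≤x _ v (_ , output-after) least read-before =
  no-read-at {k = 3 * n} (initial-invariant perm) 1≤x (inj₂ read-before) output-after
    (λ w w∈range → least w (∈-resp-↭ (↭-sym perm) w∈range))
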